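{- For each multiformula $\mho$ there exists an equivalent multiformula $\mho^d$ (resp. $\mho^c$) in SDNF (resp. SCNF): $\mho^d$ is a $\curlyvee$-disjunction of $\curlywedge$-conjunctions of labelled formulas $\sigma:\varphi$ (resp. $\mho^c$ is a $\curlywedge$-conjunction of $\curlyvee$-disjunctions of labelled formulas), such that each disjunct (resp. conjunct) contains exactly one occurrence of each label $\sigma\in\mathcal{L}(\mho)$.
   Context: Labels are finite sequences of natural numbers. Multiformulas are given by $\mho::=\sigma:\varphi\mid(\mho\curlywedge\mho)\mid(\mho\curlyvee\mho)$, with $\sigma$ a label, $\varphi$ a modal formula, $\curlywedge$ multiformula conjunction and $\curlyvee$ multiformula disjunction; $\mathcal{L}(\mho)$ is the set of labels in $\mho$. Under a multiworld interpretation $\mathcal{I}$ into a Kripke model $\mathcal{M}$: $\mathcal{M},\mathcal{I}\models\sigma:\varphi$ iff $\mathcal{M},\mathcal{I}(\sigma)\models\varphi$, and $\curlywedge$, $\curlyvee$ are interpreted classically as "both" and "at least one". $\mho_1\equiv\mho_2$ iff $\mathcal{L}(\mho_1)=\mathcal{L}(\mho_2)$ and they are true under exactly the same interpretations in all models. -}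

module Defs where

open import Data.Nat using (ℕ)
import Data.Nat as ℕ
open import Data.List using (List; []; _∷_; _++_; length; filter)
open import Data.List.Properties using (≡-dec)
open import Data.List.Membership.Propositional using (_∈_)
open import Data.Product using (_×_; Σ)
open import Data.Sum using (_⊎_)
open import Data.Empty using (⊥)
open import Data.Unit using (⊤)
open import Relation.Nullary using (¬_)
open import Relation.Binary.PropositionalEquality using (_≡_)
open import Relation.Binary.Definitions using (DecidableEquality)
open import Function.Bundles using (_⇔_)

Label : Set
Label = List ℕ

_≟ₗ_ : DecidableEquality Label
_≟ₗ_ = ≡-dec ℕ._≟_

data Fm : Set where
  atom : ℕ → Fm
  ⊥ᶠ ⊤ᶠ : Fm
  ¬ᶠ_ : Fm → Fm
  _∧ᶠ_ _∨ᶠ_ _⇒ᶠ_ : Fm → Fm → Fm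
  □_ ◇_ : Fm → Fm

record Model : Set₁ where
  field
    W : Set
    R : W → W → Set
    V : ℕ → W → Set
open Model public

_,_⊩_ : (M : Model) → W M → Fm → Set
M , w ⊩ atom p = V M p w
M , w ⊩ ⊥ᶠ = ⊥
M , w ⊩ ⊤ᶠ = ⊤
M , w ⊩ (¬ᶠ φ) = ¬ (M , w ⊩ φ)
M , w ⊩ (φ ∧ᶠ ψ) = (M , w ⊩ φ) × (M , w ⊩ ψ)
M , w ⊩ (φ ∨ᶠ ψ) = (M , w ⊩ φ) ⊎ (M , w ⊩ ψ)
M , w ⊩ (φ ⇒ᶠ ψ) = (M , w ⊩ φ) → (M , w ⊩ ψ)
M , w ⊩ (□ φ) = ∀ v → R M w v → M , v ⊩ φ
M , w ⊩ (◇ φ) = Σ (W M) λ v → R M w v × (M , v ⊩ φ)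

data Multi : Set where
  _∶_ : Label → Fm → Multi
  _⋏_ : Multi → Multi → Multi
  _⋎_ : Multi → Multi → Multi

labels : Multi → List Label
labels (σ ∶ φ) = σ ∷ []
labels (a ⋏ b) = labels a ++ labels b
labels (a ⋎ b) = labels a ++ labels b

Interp : Model → Set
Interp M = Label → W M

_,_⊨_ : (M : Model) → Interp M → Multi → Set
M , I ⊨ (σ ∶ φ) = M , I σ ⊩ φ
M , I ⊨ (a ⋏ b) = (M , I ⊨ a) × (M , I ⊨ b)
M , I ⊨ (a ⋎ b) = (M , I ⊨ a) ⊎ (M , I ⊨ b)

_≡ₘ_ : Multi → Multi → Set₁
m₁ ≡ₘ m₂ = (∀ σ → (σ ∈ labels m₁) ⇔ (σ ∈ labels m₂))
         × (∀ (M : Model) (I : Interp M) → (M , I ⊨ m₁) ⇔ (M , I ⊨ m₂))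

count : Label → List Label → ℕ
count σ xs = length (filter (σ ≟ₗ_) xs)

data IsConj : Multi → Set where
  lit  : ∀ σ φ → IsConj (σ ∶ φ)
  conj : ∀ {a b} → IsConj a → IsConj b → IsConj (a ⋏ b)

data IsDisj : Multi → Set where
  lit  : ∀ σ φ → IsDisj (σ ∶ φ)
  disj : ∀ {a b} → IsDisj a → IsDisj b → IsDisj (a ⋎ b)

ExactlyOnce : List Label → Multi → Set
ExactlyOnce L m = ∀ σ → σ ∈ L → count σ (labels m) ≡ 1

data SDNF (L : List Label) : Multi → Set where
  disjunct : ∀ {m} → IsConj m → ExactlyOnce L m → SDNF L m
  _⋎ˢ_     : ∀ {a b} → SDNF L a → SDNF L b → SDNF L (a ⋎ b)

data SCNF (L : List Label) : Multi → Set where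
  conjunct : ∀ {m} → IsDisj m → ExactlyOnce L m → SCNF L m
  _⋏ˢ_     : ∀ {a b} → SCNF L a → SCNF L b → SCNF L (a ⋏ b)

-- Fix a list D of labels. A row r : Label → Fm stands for the clause of all τ : r τ with τ in D,
-- and a table of rows for the ⋎ of its ⋏-clauses (DNF) or the ⋏ of its ⋎-clauses (CNF). The
-- literal σ : φ is the row that is φ at σ and neutral elsewhere (⊤ᶠ in a ⋏-clause, ⊥ᶠ in a
-- ⋎-clause); the connectives act on tables by concatenation and by the pointwise product of rows,
-- the latter being distributivity of × over ⊎ (resp. ⊎ over ×), which holds constructively. For D
-- the duplicate-free list of labels of ℧, writing the rows out as clauses gives strict normal forms.

module Submission where

open import Defs
open import Data.Product using (_×_; Σ; _,_; proj₂; ∃; uncurry; map₂)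
open import Data.Product.Function.NonDependent.Propositional using (_×-⇔_)
open import Data.Sum using (_⊎_; inj₁; inj₂)
import Data.Sum as Sum
open import Data.Sum.Function.Propositional using (_⊎-⇔_)
open import Data.Empty using (⊥-elim)
open import Data.Unit using (tt)
open import Data.List using (List; []; _∷_; _++_; map; length; cartesianProductWith)
open import Data.List.Properties using (filter-accept; filter-reject; filter-none)
open import Data.List.Relation.Unary.All as All using (All; []; _∷_)
import Data.List.Relation.Unary.All.Properties as All
open import Data.List.Relation.Unary.Any as Any using (Any; here; there)
import Data.List.Relation.Unary.Any.Properties as Any
open import Data.List.Relation.Unary.Unique.Propositional using (Unique; _∷_)
open import Data.List.Relation.Unary.Unique.DecPropositional.Properties _≟ₗ_ using (deduplicate-!)
open import Data.List.Membership.Propositional using (_∈_)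
open import Data.List.Membership.Propositional.Properties
  using (∈-++⁺ˡ; ∈-++⁺ʳ; ++-∈⇔; ∈-deduplicate⁺; ∈-deduplicate⁻)
open import Data.List.Relation.Binary.Subset.Propositional using (_⊆_)
open import Relation.Nullary using (yes; no; contradiction)
open import Relation.Binary.PropositionalEquality using (_≡_; refl; sym; trans; cong; subst)
open import Function using (_∘_; case_of_)
open import Function.Bundles using (_⇔_; mk⇔; Equivalence)
import Function.Properties.Equivalence as ⇔
open import Function.Properties.Inverse using (↔⇒⇔)
open import Function.Construct.Symmetry using (⇔-sym)
open import Relation.Binary.PropositionalEquality.Properties using (setoid)

All-⊎ˡ : ∀ {A B : Set} {Q : B → Set} {ys : List B} →
         All (λ y → A ⊎ Q y) ys → A ⊎ All Q ys
All-⊎ˡ []            = inj₂ []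
All-⊎ˡ (inj₁ a ∷ _)  = inj₁ a
All-⊎ˡ (inj₂ q ∷ qs) = Sum.map₂ (q ∷_) (All-⊎ˡ qs)

All-cartesianProductWith⁻ :
  ∀ {A B C : Set} {P : A → Set} {Q : B → Set} {R : C → Set} {f : A → B → C} →
  (∀ {x y} → R (f x y) → P x ⊎ Q y) →
  ∀ xs ys → All R (cartesianProductWith f xs ys) → All P xs ⊎ All Q ys
All-cartesianProductWith⁻ split []       ys _ = inj₁ []
All-cartesianProductWith⁻ {f = f} split (x ∷ xs) ys h
  with All-⊎ˡ (All.map split (All.map⁻ (All.++⁻ˡ (map (f x) ys) h)))
... | inj₂ qs = inj₂ qs
... | inj₁ px = Sum.map₁ (px ∷_) (All-cartesianProductWith⁻ split xs ys (All.++⁻ʳ (map (f x) ys) h))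

count-unique : ∀ {σ ds} → Unique ds → σ ∈ ds → count σ ds ≡ 1
count-unique {σ} (σ∉ ∷ _) (here refl) =
  cong length (trans (filter-accept (σ ≟ₗ_) refl) (cong (σ ∷_) (filter-none (σ ≟ₗ_) σ∉)))
count-unique {σ} (d∉ ∷ u) (there σ∈) =
  trans (cong length (filter-reject (σ ≟ₗ_) (All.lookup d∉ σ∈ ∘ sym))) (count-unique u σ∈)

Row : Set
Row = Label → Fm

_∧ʳ_ _∨ʳ_ : Row → Row → Row
(r ∧ʳ s) τ = r τ ∧ᶠ s τ
(r ∨ʳ s) τ = r τ ∨ᶠ s τ

singleRow : Fm → Label → Fm → Row
singleRow e σ φ τ with τ ≟ₗ σ
... | yes _ = φ
... | no _  = e

singleRow-self : ∀ e σ φ → singleRow e σ φ σ ≡ φ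
singleRow-self e σ φ with σ ≟ₗ σ
... | yes _   = refl
... | no σ≢σ = contradiction refl σ≢σ

dnf : Multi → List Row
dnf (σ ∶ φ) = singleRow ⊤ᶠ σ φ ∷ []
dnf (a ⋏ b) = cartesianProductWith _∧ʳ_ (dnf a) (dnf b)
dnf (a ⋎ b) = dnf a ++ dnf b

cnf : Multi → List Row
cnf (σ ∶ φ) = singleRow ⊥ᶠ σ φ ∷ []
cnf (a ⋏ b) = cnf a ++ cnf b
cnf (a ⋎ b) = cartesianProductWith _∨ʳ_ (cnf a) (cnf b)

conjClause disjClause : Row → Label → List Label → Multi
conjClause r d []       = d ∶ r d
conjClause r d (e ∷ es) = (d ∶ r d) ⋏ conjClause r e es
disjClause r d []       = d ∶ r d
disjClause r d (e ∷ es) = (d ∶ r d) ⋎ disjClause r e es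

-- Multiformulas cannot be empty, so the empty table becomes a clause of ⊥ᶠ (resp. ⊤ᶠ).
sdnf scnf : Label → List Label → List Row → Multi
sdnf d ds []           = conjClause (λ _ → ⊥ᶠ) d ds
sdnf d ds (r ∷ [])     = conjClause r d ds
sdnf d ds (r ∷ s ∷ rs) = conjClause r d ds ⋎ sdnf d ds (s ∷ rs)
scnf d ds []           = disjClause (λ _ → ⊤ᶠ) d ds
scnf d ds (r ∷ [])     = disjClause r d ds
scnf d ds (r ∷ s ∷ rs) = disjClause r d ds ⋏ scnf d ds (s ∷ rs)

module Semantics (M : Model) (I : Interp M) where

  Sat : Label → Fm → Set
  Sat σ φ = M , I σ ⊩ φ

  Holds : Row → Label → Set
  Holds r τ = Sat τ (r τ)

  DnfHolds CnfHolds : List Label → List Row → Set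
  DnfHolds D = Any (λ r → All (Holds r) D)
  CnfHolds D = All (λ r → Any (Holds r) D)

  All-singleRow⊤ : ∀ {σ φ D} → σ ∈ D → All (Holds (singleRow ⊤ᶠ σ φ)) D ⇔ Sat σ φ
  All-singleRow⊤ {σ} {φ} σ∈D =
    mk⇔ (λ h → subst (Sat σ) (singleRow-self ⊤ᶠ σ φ) (All.lookup h σ∈D))
        (λ p → All.tabulate λ {τ} _ → holds p τ)
    where
    holds : Sat σ φ → ∀ τ → Holds (singleRow ⊤ᶠ σ φ) τ
    holds p τ with τ ≟ₗ σ
    ... | yes refl = p
    ... | no _     = tt

  Any-singleRow⊥ : ∀ {σ φ D} → σ ∈ D → Any (Holds (singleRow ⊥ᶠ σ φ)) D ⇔ Sat σ φ
  Any-singleRow⊥ {σ} {φ} σ∈D =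
    mk⇔ (λ h → sound (Any.lookup h) (Any.lookup-result h))
        (λ p → Any.map (λ { refl → subst (Sat σ) (sym (singleRow-self ⊥ᶠ σ φ)) p }) σ∈D)
    where
    sound : ∀ τ → Holds (singleRow ⊥ᶠ σ φ) τ → Sat σ φ
    sound τ with τ ≟ₗ σ
    ... | yes refl = λ p → p
    ... | no _     = λ ()

  DnfHolds-∧ : ∀ {D rs ss} →
    (DnfHolds D rs × DnfHolds D ss) ⇔ DnfHolds D (cartesianProductWith _∧ʳ_ rs ss)
  DnfHolds-∧ {rs = rs} {ss} =
    mk⇔ (uncurry (Any.cartesianProductWith⁺ _ (λ p q → All.zip (p , q))))
        (Any.cartesianProductWith⁻ _ All.unzip rs ss)

  CnfHolds-∨ : ∀ {D rs ss} →
    (CnfHolds D rs ⊎ CnfHolds D ss) ⇔ CnfHolds D (cartesianProductWith _∨ʳ_ rs ss)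
  CnfHolds-∨ {rs = rs} {ss} =
    mk⇔ (λ h → All.cartesianProductWith⁺ (setoid _) (setoid _) _ rs ss λ r∈ s∈ →
                 Any.Any-⊎⁺ (Sum.map (λ hr → All.lookup hr r∈) (λ hs → All.lookup hs s∈) h))
        (All-cartesianProductWith⁻ Any.Any-⊎⁻ rs ss)

  dnf-correct : ∀ ℧ {D} → labels ℧ ⊆ D → (M , I ⊨ ℧) ⇔ DnfHolds D (dnf ℧)
  dnf-correct (σ ∶ φ) ⊆D = ⇔.trans (⇔-sym (All-singleRow⊤ (⊆D (here refl)))) (↔⇒⇔ Any.pure↔)
  dnf-correct (a ⋏ b) ⊆D =
    ⇔.trans (dnf-correct a (⊆D ∘ ∈-++⁺ˡ) ×-⇔ dnf-correct b (⊆D ∘ ∈-++⁺ʳ (labels a))) DnfHolds-∧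
  dnf-correct (a ⋎ b) ⊆D =
    ⇔.trans (dnf-correct a (⊆D ∘ ∈-++⁺ˡ) ⊎-⇔ dnf-correct b (⊆D ∘ ∈-++⁺ʳ (labels a))) (↔⇒⇔ Any.++↔)

  cnf-correct : ∀ ℧ {D} → labels ℧ ⊆ D → (M , I ⊨ ℧) ⇔ CnfHolds D (cnf ℧)
  cnf-correct (σ ∶ φ) ⊆D = ⇔.trans (⇔-sym (Any-singleRow⊥ (⊆D (here refl)))) (mk⇔ (_∷ []) All.singleton⁻)
  cnf-correct (a ⋏ b) ⊆D =
    ⇔.trans (cnf-correct a (⊆D ∘ ∈-++⁺ˡ) ×-⇔ cnf-correct b (⊆D ∘ ∈-++⁺ʳ (labels a))) (↔⇒⇔ All.++↔)
  cnf-correct (a ⋎ b) ⊆D =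
    ⇔.trans (cnf-correct a (⊆D ∘ ∈-++⁺ˡ) ⊎-⇔ cnf-correct b (⊆D ∘ ∈-++⁺ʳ (labels a))) CnfHolds-∨

  conjClause-correct : ∀ r d ds → (M , I ⊨ conjClause r d ds) ⇔ All (Holds r) (d ∷ ds)
  conjClause-correct r d []       = mk⇔ (_∷ []) All.singleton⁻
  conjClause-correct r d (e ∷ es) = ⇔.trans (⇔.refl ×-⇔ conjClause-correct r e es) (mk⇔ (uncurry _∷_) All.uncons)

  disjClause-correct : ∀ r d ds → (M , I ⊨ disjClause r d ds) ⇔ Any (Holds r) (d ∷ ds)
  disjClause-correct r d []       = ↔⇒⇔ Any.pure↔
  disjClause-correct r d (e ∷ es) = ⇔.trans (⇔.refl ⊎-⇔ disjClause-correct r e es) (↔⇒⇔ (Any.∷↔ _))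

  sdnf-correct : ∀ d ds rs → (M , I ⊨ sdnf d ds rs) ⇔ DnfHolds (d ∷ ds) rs
  sdnf-correct d ds [] =
    mk⇔ (λ h → ⊥-elim (All.head (Equivalence.to (conjClause-correct _ d ds) h))) (λ ())
  sdnf-correct d ds (r ∷ [])     = ⇔.trans (conjClause-correct r d ds) (↔⇒⇔ Any.pure↔)
  sdnf-correct d ds (r ∷ s ∷ rs) =
    ⇔.trans (conjClause-correct r d ds ⊎-⇔ sdnf-correct d ds (s ∷ rs)) (↔⇒⇔ (Any.∷↔ _))

  scnf-correct : ∀ d ds rs → (M , I ⊨ scnf d ds rs) ⇔ CnfHolds (d ∷ ds) rs
  scnf-correct d ds [] =
    mk⇔ (λ _ → []) (λ _ → Equivalence.from (disjClause-correct _ d ds) (here tt))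
  scnf-correct d ds (r ∷ [])     = ⇔.trans (disjClause-correct r d ds) (mk⇔ (_∷ []) All.singleton⁻)
  scnf-correct d ds (r ∷ s ∷ rs) =
    ⇔.trans (disjClause-correct r d ds ×-⇔ scnf-correct d ds (s ∷ rs)) (mk⇔ (uncurry _∷_) All.uncons)

conjClause-labels : ∀ r d ds → labels (conjClause r d ds) ≡ d ∷ ds
conjClause-labels r d []       = refl
conjClause-labels r d (e ∷ es) = cong (d ∷_) (conjClause-labels r e es)

disjClause-labels : ∀ r d ds → labels (disjClause r d ds) ≡ d ∷ ds
disjClause-labels r d []       = refl
disjClause-labels r d (e ∷ es) = cong (d ∷_) (disjClause-labels r e es)

∈-labels-conjClause : ∀ {σ} r d ds → σ ∈ labels (conjClause r d ds) ⇔ σ ∈ d ∷ ds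
∈-labels-conjClause r d ds rewrite conjClause-labels r d ds = ⇔.refl

∈-labels-disjClause : ∀ {σ} r d ds → σ ∈ labels (disjClause r d ds) ⇔ σ ∈ d ∷ ds
∈-labels-disjClause r d ds rewrite disjClause-labels r d ds = ⇔.refl

∈-labels-sdnf : ∀ {σ} d ds rs → σ ∈ labels (sdnf d ds rs) ⇔ σ ∈ d ∷ ds
∈-labels-sdnf d ds []           = ∈-labels-conjClause _ d ds
∈-labels-sdnf d ds (r ∷ [])     = ∈-labels-conjClause r d ds
∈-labels-sdnf d ds (r ∷ s ∷ rs) =
  ⇔.trans ++-∈⇔ (⇔.trans (∈-labels-conjClause r d ds ⊎-⇔ ∈-labels-sdnf d ds (s ∷ rs)) (mk⇔ Sum.reduce inj₁))

∈-labels-scnf : ∀ {σ} d ds rs → σ ∈ labels (scnf d ds rs) ⇔ σ ∈ d ∷ ds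
∈-labels-scnf d ds []           = ∈-labels-disjClause _ d ds
∈-labels-scnf d ds (r ∷ [])     = ∈-labels-disjClause r d ds
∈-labels-scnf d ds (r ∷ s ∷ rs) =
  ⇔.trans ++-∈⇔ (⇔.trans (∈-labels-disjClause r d ds ⊎-⇔ ∈-labels-scnf d ds (s ∷ rs)) (mk⇔ Sum.reduce inj₁))

conjClause-isConj : ∀ r d ds → IsConj (conjClause r d ds)
conjClause-isConj r d []       = lit d (r d)
conjClause-isConj r d (e ∷ es) = conj (lit d (r d)) (conjClause-isConj r e es)

disjClause-isDisj : ∀ r d ds → IsDisj (disjClause r d ds)
disjClause-isDisj r d []       = lit d (r d)
disjClause-isDisj r d (e ∷ es) = disj (lit d (r d)) (disjClause-isDisj r e es)

exactlyOnce : ∀ {L D} m → labels m ≡ D → Unique D → L ⊆ D → ExactlyOnce L m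
exactlyOnce m eq u L⊆D σ σ∈L = subst (λ xs → count σ xs ≡ 1) (sym eq) (count-unique u (L⊆D σ∈L))

sdnf-SDNF : ∀ {L d ds} → Unique (d ∷ ds) → L ⊆ d ∷ ds → ∀ rs → SDNF L (sdnf d ds rs)
sdnf-SDNF {d = d} {ds} u L⊆D = go
  where
  clause : ∀ r → SDNF _ (conjClause r d ds)
  clause r = disjunct (conjClause-isConj r d ds) (exactlyOnce (conjClause r d ds) (conjClause-labels r d ds) u L⊆D)
  go : ∀ rs → SDNF _ (sdnf d ds rs)
  go []           = clause _
  go (r ∷ [])     = clause r
  go (r ∷ s ∷ rs) = clause r ⋎ˢ go (s ∷ rs)

scnf-SCNF : ∀ {L d ds} → Unique (d ∷ ds) → L ⊆ d ∷ ds → ∀ rs → SCNF L (scnf d ds rs)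
scnf-SCNF {d = d} {ds} u L⊆D = go
  where
  clause : ∀ r → SCNF _ (disjClause r d ds)
  clause r = conjunct (disjClause-isDisj r d ds) (exactlyOnce (disjClause r d ds) (disjClause-labels r d ds) u L⊆D)
  go : ∀ rs → SCNF _ (scnf d ds rs)
  go []           = clause _
  go (r ∷ [])     = clause r
  go (r ∷ s ∷ rs) = clause r ⋏ˢ go (s ∷ rs)

some-label : ∀ ℧ → ∃ (_∈ labels ℧)
some-label (σ ∶ φ) = σ , here refl
some-label (a ⋏ b) = map₂ ∈-++⁺ˡ (some-label a)
some-label (a ⋎ b) = map₂ ∈-++⁺ˡ (some-label a)

normalForms : ∀ ℧ {D} → Unique D → labels ℧ ⊆ D → D ⊆ labels ℧
  → Σ Multi (λ ℧ᵈ → (℧ᵈ ≡ₘ ℧) × SDNF (labels ℧) ℧ᵈ)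
    × Σ Multi (λ ℧ᶜ → (℧ᶜ ≡ₘ ℧) × SCNF (labels ℧) ℧ᶜ)
normalForms ℧ {[]} _ ⊆D _ = case ⊆D (proj₂ (some-label ℧)) of λ ()
normalForms ℧ {d ∷ ds} u ⊆D ⊇D =
    ( sdnf d ds (dnf ℧)
    , ( (λ _ → ⇔.trans (∈-labels-sdnf d ds (dnf ℧)) D⇔labels)
      , (λ M I → ⇔.trans (sdnf-correct M I d ds (dnf ℧)) (⇔-sym (dnf-correct M I ℧ ⊆D))) )
    , sdnf-SDNF u ⊆D (dnf ℧) )
  , ( scnf d ds (cnf ℧)
    , ( (λ _ → ⇔.trans (∈-labels-scnf d ds (cnf ℧)) D⇔labels)
      , (λ M I → ⇔.trans (scnf-correct M I d ds (cnf ℧)) (⇔-sym (cnf-correct M I ℧ ⊆D))) )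
    , scnf-SCNF u ⊆D (cnf ℧) )
  where
  open Semantics
  D⇔labels : ∀ {σ} → σ ∈ d ∷ ds ⇔ σ ∈ labels ℧
  D⇔labels = mk⇔ ⊇D ⊆D

lemma4 : (℧ : Multi)
    → Σ Multi (λ ℧ᵈ → (℧ᵈ ≡ₘ ℧) × SDNF (labels ℧) ℧ᵈ)
      × Σ Multi (λ ℧ᶜ → (℧ᶜ ≡ₘ ℧) × SCNF (labels ℧) ℧ᶜ)
lemma4 ℧ =
  normalForms ℧ (deduplicate-! (labels ℧)) (∈-deduplicate⁺ _≟ₗ_) (∈-deduplicate⁻ _≟ₗ_ (labels ℧))
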